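{- For every $\mathcal{L}_{A_m}^{\Box}$-formula $\varphi$: if $\varphi$ is derivable in the axiom system $K(A_m)$, then $\varphi$ is $K(A)$-valid.
   Context: $\mathcal{L}_{A_m}^{\Box}$-formulas are built from a countably infinite set $\mathrm{Var}$ of variables using the binary connective $\to$ and unary $\Box$. Fix $p_0\in\mathrm{Var}$ and abbreviate $\overline0:=p_0\to p_0$, $\neg\varphi:=\varphi\to\overline0$, $\varphi\&\psi:=\neg\varphi\to\psi$, $0\varphi:=\overline0$, $(n+1)\varphi:=\varphi\&(n\varphi)$. A $K(A)$-model $(W,R,V)$ consists of a non-empty set $W$, $R\subseteq W\times W$, and $V:\mathrm{Var}\times W\to[-r,r]$ for some real $r\ge0$, extended by $V(\varphi\to\psi,x)=V(\psi,x)-V(\varphi,x)$ and $V(\Box\varphi,x)=\inf_{\mathbb R}\{V(\varphi,y):Rxy\}$ (infimum of $\emptyset$ is $0$). $\varphi$ is $K(A)$-valid if $V(\varphi,x)\ge0$ for all worlds of all $K(A)$-models. The axiom system $K(A_m)$ has axiom schemas (B) $(\varphi\to\psi)\to((\psi\to\chi)\to(\varphi\to\chi))$; (C) $(\varphi\to(\psi\to\chi))\to(\psi\to(\varphi\to\chi))$; (I) $\varphi\to\varphi$; (A) $((\varphi\to\psi)\to\psi)\to\varphi$; (K) $\Box(\varphi\to\psi)\to(\Box\varphi\to\Box\psi)$; (D$_n$) $\Box(n\varphi)\to n\Box\varphi$ for $n\ge2$; and rules (mp) from $\varphi$ and $\varphi\to\psi$ infer $\psi$; (nec) from $\varphi$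 infer $\Box\varphi$; (con$_n$) from $n\varphi$ infer $\varphi$, for $n\ge2$. A derivation is a finite sequence of formulas each of which is an axiom instance or follows from earlier ones by a rule. -}

module Defs where

open import Level using (0ℓ)
open import Data.Nat using (ℕ; zero; suc)
open import Data.Product using (Σ; _×_; ∃; ∃-syntax; _,_)
open import Data.Sum using (_⊎_)
open import Relation.Nullary using (¬_)
open import Relation.Binary.PropositionalEquality using (_≡_)
open import Algebra.Structures using (IsCommutativeRing)
open import Relation.Binary.Structures using (IsTotalOrder)

-- The real numbers, axiomatised as a Dedekind-complete ordered field.
-- (agda-stdlib has no real numbers; any such structure is isomorphic
-- to ℝ, and the theorem quantifies over all of them.)

record IsInfimum {C : Set} (_≤_ : C → C → Set) (P : C → Set) (v : C) : Set where
  field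
    lower    : ∀ b → P b → v ≤ b
    greatest : ∀ w → (∀ b → P b → w ≤ b) → w ≤ v

record RealField : Set₁ where
  infixl 6 _+_ _-_
  infixl 7 _*_
  infix  4 _≤_
  field
    Carrier : Set
    _+_ _*_ : Carrier → Carrier → Carrier
    -_      : Carrier → Carrier
    0# 1#   : Carrier
    _≤_     : Carrier → Carrier → Set
    isCommutativeRing : IsCommutativeRing _≡_ _+_ _*_ -_ 0# 1#
    isTotalOrder      : IsTotalOrder _≡_ _≤_
    0≢1     : ¬ (0# ≡ 1#)
    inverse : ∀ x → ¬ (x ≡ 0#) → Σ Carrier (λ y → x * y ≡ 1#)
    +-mono  : ∀ x y z → x ≤ y → x + z ≤ y + z
    *-nonneg : ∀ x y → 0# ≤ x → 0# ≤ y → 0# ≤ x * y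
    complete : (P : Carrier → Set) → (∃[ a ] P a) →
               (∃[ l ] (∀ b → P b → l ≤ b)) →
               ∃[ v ] IsInfimum _≤_ P v

  _-_ : Carrier → Carrier → Carrier
  x - y = x + (- y)

Var : Set
Var = ℕ

infixr 5 _⇒_
data Fm : Set where
  var : Var → Fm
  _⇒_ : Fm → Fm → Fm
  □_  : Fm → Fm

p₀ : Var
p₀ = 0

0̄ : Fm
0̄ = var p₀ ⇒ var p₀

~_ : Fm → Fm
~ φ = φ ⇒ 0̄

_&_ : Fm → Fm → Fm
φ & ψ = (~ φ) ⇒ ψ

_·_ : ℕ → Fm → Fm
zero  · φ = 0̄
suc n · φ = φ & (n · φ)

-- The axiom system K(A_m); derivability as an inductive predicate
-- (equivalent to existence of a finite derivation sequence).

data ⊢_ : Fm → Set where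
  axB  : ∀ φ ψ χ → ⊢ ((φ ⇒ ψ) ⇒ ((ψ ⇒ χ) ⇒ (φ ⇒ χ)))
  axC  : ∀ φ ψ χ → ⊢ ((φ ⇒ (ψ ⇒ χ)) ⇒ (ψ ⇒ (φ ⇒ χ)))
  axI  : ∀ φ → ⊢ (φ ⇒ φ)
  axA  : ∀ φ ψ → ⊢ (((φ ⇒ ψ) ⇒ ψ) ⇒ φ)
  axK  : ∀ φ ψ → ⊢ (□ (φ ⇒ ψ) ⇒ (□ φ ⇒ □ ψ))
  axD  : ∀ n φ → 2 Data.Nat.≤ n → ⊢ (□ (n · φ) ⇒ (n · (□ φ)))
  mp   : ∀ {φ ψ} → ⊢ φ → ⊢ (φ ⇒ ψ) → ⊢ ψ
  nec  : ∀ {φ} → ⊢ φ → ⊢ (□ φ)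
  con  : ∀ {φ} n → 2 Data.Nat.≤ n → ⊢ (n · φ) → ⊢ φ

module _ (ℝ : RealField) where
  open RealField ℝ

  record KAModel : Set₁ where
    field
      W   : Set
      w₀  : W                       -- W is non-empty
      R   : W → W → Set
      r   : Carrier
      0≤r : 0# ≤ r
      V   : Var → W → Carrier
      bounded : ∀ p x → ((- r) ≤ V p x) × (V p x ≤ r)

  -- Val M φ x v : "V(φ,x) = v" (the extended valuation, as a relation;
  -- it is functional and, classically, total).
  Val : (M : KAModel) → Fm → KAModel.W M → Carrier → Set
  Val M (var p) x v = v ≡ KAModel.V M p x
  Val M (φ ⇒ ψ) x v = ∃[ a ] ∃[ b ] (Val M φ x a × Val M ψ x b × v ≡ b - a)
  Val M (□ φ)   x v =
      ((¬ (∃[ y ] KAModel.R M x y)) × v ≡ 0#)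
    ⊎ ((∃[ y ] KAModel.R M x y) ×
       IsInfimum _≤_ (λ b → ∃[ y ] (KAModel.R M x y × Val M φ y b)) v)

KA-valid : Fm → Set₁
KA-valid φ = (ℝ : RealField) → (M : KAModel ℝ) → (x : KAModel.W M) →
             (v : RealField.Carrier ℝ) → Val ℝ M φ x v → RealField._≤_ ℝ (RealField.0# ℝ) v

module Submission where

-- The propositional axioms are identities of
-- abelian-group arithmetic, (K) is superadditivity of infima, (D_n) and (con_n) divide
-- by the positive element n · 1.  Constructively, Val is a functional relation that is
-- total only up to double negation, so every case needs ≤ to be ¬¬-stable; this follows
-- from Dedekind completeness, since a lower bound of all positive elements is ≤ 0.

open import Level using (0ℓ)
open import Data.Nat using (zero; suc)
open import Data.Product using (_×_; ∃; ∃₂; ∃-syntax; _,_; proj₁; proj₂)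
open import Data.Sum using (inj₁; inj₂)
open import Data.Empty using (⊥-elim)
open import Effect.Monad using (RawMonad)
open import Relation.Nullary using (¬_; yes; no)
open import Relation.Nullary.Decidable using (¬¬-excluded-middle)
open import Relation.Nullary.Negation using (Stable; ¬¬-Monad; ¬¬-map)
open import Relation.Binary.PropositionalEquality
  using (_≡_; _≢_; refl; sym; trans; cong; cong₂; subst; subst₂; module ≡-Reasoning)
open import Algebra.Bundles using (CommutativeRing)
open import Algebra.Structures using (IsCommutativeRing)
open import Relation.Binary.Structures using (IsTotalOrder)

open import Defs

module OrderedFieldProperties (ℝ : RealField) where
  open RealField ℝ
  open IsCommutativeRing isCommutativeRing
    using ( +-assoc; +-comm; +-identityˡ; +-identityʳ; -‿inverseʳ
          ; *-comm; *-assoc; *-identityˡ; zeroʳ)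
  open IsTotalOrder isTotalOrder public
    using (antisym; total) renaming (refl to ≤-refl; trans to ≤-trans; reflexive to ≤-reflexive)
  open IsInfimum
  open ≡-Reasoning

  commutativeRing : CommutativeRing 0ℓ 0ℓ
  commutativeRing = record { isCommutativeRing = isCommutativeRing }

  open CommutativeRing commutativeRing using (ring; semiring)
  open import Algebra.Properties.Ring ring public
    using (-‿involutive; -0#≈0#; -‿+-comm; ⁻¹-anti-homo‿-; xyx⁻¹≈y
          ; //-rightDividesˡ; \\-leftDividesʳ; -‿distribˡ-*; -‿distribʳ-*; x[y-z]≈xy-xz)
  open import Algebra.Properties.Semiring.Mult semiring public
    using (×-assoc-*) renaming (_×_ to _·ℝ_)

  sub-sub-comm : ∀ x y z → (x - y) - z ≡ (x - z) - y
  sub-sub-comm x y z = begin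
    (x + - y) + - z  ≡⟨ +-assoc x (- y) (- z) ⟩
    x + (- y + - z)  ≡⟨ cong (x +_) (+-comm (- y) (- z)) ⟩
    x + (- z + - y)  ≡⟨ +-assoc x (- z) (- y) ⟨
    (x + - z) + - y  ∎

  sub-sub-cancel : ∀ x y → x - (x - y) ≡ y
  sub-sub-cancel x y = begin
    x + - (x - y)  ≡⟨ cong (x +_) (⁻¹-anti-homo‿- x y) ⟩
    x + (y - x)    ≡⟨ +-assoc x y (- x) ⟨
    (x + y) - x    ≡⟨ xyx⁻¹≈y x y ⟩
    y              ∎

  sub-sub-cancelˡ : ∀ x y z → (x - y) - (x - z) ≡ z - y
  sub-sub-cancelˡ x y z = trans (sub-sub-comm x y (x - z)) (cong (_- y) (sub-sub-cancel x z))

  sub-sub : ∀ x y z → (x - y) - z ≡ x - (y + z)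
  sub-sub x y z = trans (+-assoc x (- y) (- z)) (cong (x +_) (-‿+-comm y z))

  sub-[0-y] : ∀ x y → x - (0# - y) ≡ y + x
  sub-[0-y] x y = begin
    x + - (0# + - y)  ≡⟨ cong (λ u → x + - u) (+-identityˡ (- y)) ⟩
    x + - - y         ≡⟨ cong (x +_) (-‿involutive y) ⟩
    x + y             ≡⟨ +-comm x y ⟩
    y + x             ∎

  neg-*-neg : ∀ x y → - x * - y ≡ x * y
  neg-*-neg x y = begin
    - x * - y      ≡⟨ -‿distribˡ-* x (- y) ⟨
    - (x * - y)    ≡⟨ cong -_ (-‿distribʳ-* x y) ⟨
    - - (x * y)    ≡⟨ -‿involutive (x * y) ⟩
    x * y          ∎

  ·ℝ-as-* : ∀ n x → n ·ℝ x ≡ (n ·ℝ 1#) * x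
  ·ℝ-as-* n x = sym (trans (×-assoc-* n 1# x) (cong (n ·ℝ_) (*-identityˡ x)))

  +-monoˡ-≤ : ∀ z {x y} → x ≤ y → x + z ≤ y + z
  +-monoˡ-≤ z {x} {y} = +-mono x y z

  +-monoʳ-≤ : ∀ z {x y} → x ≤ y → z + x ≤ z + y
  +-monoʳ-≤ z {x} {y} x≤y = subst₂ _≤_ (+-comm x z) (+-comm y z) (+-mono x y z x≤y)

  +-mono-≤ : ∀ {a b c d} → a ≤ b → c ≤ d → a + c ≤ b + d
  +-mono-≤ {b = b} a≤b c≤d = ≤-trans (+-monoˡ-≤ _ a≤b) (+-monoʳ-≤ b c≤d)

  +-cancelˡ-≤ : ∀ z {x y} → z + x ≤ z + y → x ≤ y
  +-cancelˡ-≤ z {x} {y} z+x≤z+y =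
    subst₂ _≤_ (\\-leftDividesʳ z x) (\\-leftDividesʳ z y) (+-monoʳ-≤ (- z) z+x≤z+y)

  x≤y⇒0≤y-x : ∀ {x y} → x ≤ y → 0# ≤ y - x
  x≤y⇒0≤y-x {x} x≤y = subst₂ _≤_ (-‿inverseʳ x) refl (+-monoˡ-≤ (- x) x≤y)

  0≤y-x⇒x≤y : ∀ {x y} → 0# ≤ y - x → x ≤ y
  0≤y-x⇒x≤y {x} {y} 0≤y-x =
    subst₂ _≤_ (+-identityˡ x) (//-rightDividesˡ x y) (+-monoˡ-≤ x 0≤y-x)

  neg-mono-≤ : ∀ {x y} → x ≤ y → - y ≤ - x
  neg-mono-≤ {x} {y} x≤y = 0≤y-x⇒x≤y (subst (0# ≤_) y-x≡-x--y (x≤y⇒0≤y-x x≤y))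
    where
    y-x≡-x--y : y - x ≡ - x - - y
    y-x≡-x--y = trans (+-comm y (- x)) (cong (- x +_) (sym (-‿involutive y)))

  nonNeg⇒neg-nonPos : ∀ {x} → 0# ≤ x → - x ≤ 0#
  nonNeg⇒neg-nonPos 0≤x = subst (_ ≤_) -0#≈0# (neg-mono-≤ 0≤x)

  neg-nonPos⇒nonNeg : ∀ {x} → - x ≤ 0# → 0# ≤ x
  neg-nonPos⇒nonNeg {x} -x≤0 = subst₂ _≤_ -0#≈0# (-‿involutive x) (neg-mono-≤ -x≤0)

  *-monoˡ-≤-nonNeg : ∀ {x y z} → 0# ≤ z → x ≤ y → z * x ≤ z * y
  *-monoˡ-≤-nonNeg {x} {y} {z} 0≤z x≤y =
    0≤y-x⇒x≤y (subst (0# ≤_) (x[y-z]≈xy-xz z y x) (*-nonneg z (y - x) 0≤z (x≤y⇒0≤y-x x≤y)))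

  square-nonNeg : ∀ x → 0# ≤ x * x
  square-nonNeg x with total 0# x
  ... | inj₁ 0≤x = *-nonneg x x 0≤x 0≤x
  ... | inj₂ x≤0 = subst (0# ≤_) (neg-*-neg x x) (*-nonneg (- x) (- x) 0≤-x 0≤-x)
    where
    0≤-x : 0# ≤ - x
    0≤-x = subst (_≤ - x) -0#≈0# (neg-mono-≤ x≤0)

  0≤1 : 0# ≤ 1#
  0≤1 = subst (0# ≤_) (*-identityˡ 1#) (square-nonNeg 1#)

  1≰0 : ¬ (1# ≤ 0#)
  1≰0 1≤0 = 0≢1 (antisym 0≤1 1≤0)

  Positive : Carrier → Set
  Positive x = 0# ≤ x × x ≢ 0#

  ·ℝ1-nonNeg : ∀ n → 0# ≤ n ·ℝ 1#
  ·ℝ1-nonNeg zero    = ≤-refl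
  ·ℝ1-nonNeg (suc n) = subst (_≤ suc n ·ℝ 1#) (+-identityˡ 0#) (+-mono-≤ 0≤1 (·ℝ1-nonNeg n))

  suc·ℝ1-positive : ∀ n → Positive (suc n ·ℝ 1#)
  suc·ℝ1-positive n = ·ℝ1-nonNeg (suc n) , λ n+1≡0 →
    1≰0 (subst₂ _≤_ (+-identityʳ 1#) n+1≡0 (+-monoʳ-≤ 1# (·ℝ1-nonNeg n)))

  inverse-nonNeg : ∀ {x y} → 0# ≤ x → x * y ≡ 1# → 0# ≤ y
  inverse-nonNeg {x} {y} 0≤x xy≡1 with total 0# y
  ... | inj₁ 0≤y = 0≤y
  ... | inj₂ y≤0 =
    ⊥-elim (1≰0 (subst₂ _≤_ xy≡1 (zeroʳ x) (*-monoˡ-≤-nonNeg 0≤x y≤0)))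

  positive-inverse : ∀ {x} → Positive x → ∃[ y ] (x * y ≡ 1# × 0# ≤ y)
  positive-inverse {x} (0≤x , x≢0) with inverse x x≢0
  ... | y , xy≡1 = y , xy≡1 , inverse-nonNeg 0≤x xy≡1

  *-cancelˡ-≤-pos : ∀ {n x y} → Positive n → n * x ≤ n * y → x ≤ y
  *-cancelˡ-≤-pos {n} {x} {y} n>0 nx≤ny with positive-inverse n>0
  ... | m , nm≡1 , 0≤m = subst₂ _≤_ (cancel x) (cancel y) (*-monoˡ-≤-nonNeg 0≤m nx≤ny)
    where
    cancel : ∀ z → m * (n * z) ≡ z
    cancel z = begin
      m * (n * z)  ≡⟨ *-assoc m n z ⟨
      (m * n) * z  ≡⟨ cong (_* z) (trans (*-comm m n) nm≡1) ⟩
      1# * z       ≡⟨ *-identityˡ z ⟩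
      z            ∎

  Bounded : Carrier → Carrier → Set
  Bounded k v = - k ≤ v × v ≤ k

  0-bounded : ∀ {k} → 0# ≤ k → Bounded k 0#
  0-bounded 0≤k = nonNeg⇒neg-nonPos 0≤k , 0≤k

  sub-bounded : ∀ {k l a b} → Bounded k a → Bounded l b → Bounded (k + l) (b - a)
  sub-bounded {k} {l} {a} {b} (-k≤a , a≤k) (-l≤b , b≤l) = -[k+l]≤b-a , b-a≤k+l
    where
    -[k+l]≤b-a : - (k + l) ≤ b - a
    -[k+l]≤b-a = subst (_≤ b - a) (trans (+-comm (- l) (- k)) (-‿+-comm k l))
              (+-mono-≤ -l≤b (neg-mono-≤ a≤k))
    b-a≤k+l : b - a ≤ k + l
    b-a≤k+l = subst (b - a ≤_) (+-comm l k)
              (+-mono-≤ b≤l (subst (- a ≤_) (-‿involutive k) (neg-mono-≤ -k≤a)))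

  infimum-unique : ∀ {P u v} → IsInfimum _≤_ P u → IsInfimum _≤_ P v → u ≡ v
  infimum-unique u-inf v-inf =
    antisym (greatest v-inf _ (lower u-inf))
            (greatest u-inf _ (lower v-inf))

  1-positive : Positive 1#
  1-positive = 0≤1 , λ 1≡0 → 0≢1 (sym 1≡0)

  -- Halving shows that the infimum v of the positives satisfies v + v ≤ v.
  ≤-positives⇒≤0 : ∀ {x} → (∀ t → Positive t → x ≤ t) → x ≤ 0#
  ≤-positives⇒≤0 {x} x≤positives
    with complete Positive (1# , 1-positive) (0# , λ _ → proj₁)
       | positive-inverse (suc·ℝ1-positive 1)
  ... | v , v-inf | h , 2h≡1 , 0≤h = ≤-trans (greatest v-inf x x≤positives) v≤0
    where
    halves : ∀ t → t * h + t * h ≡ t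
    halves t = begin
      t * h + t * h             ≡⟨ cong (t * h +_) (+-identityʳ (t * h)) ⟨
      2 ·ℝ (t * h)              ≡⟨ ·ℝ-as-* 2 (t * h) ⟩
      (2 ·ℝ 1#) * (t * h)       ≡⟨ cong ((2 ·ℝ 1#) *_) (*-comm t h) ⟩
      (2 ·ℝ 1#) * (h * t)       ≡⟨ *-assoc (2 ·ℝ 1#) h t ⟨
      ((2 ·ℝ 1#) * h) * t       ≡⟨ cong (_* t) 2h≡1 ⟩
      1# * t                    ≡⟨ *-identityˡ t ⟩
      t                         ∎
    half-positive : ∀ t → Positive t → Positive (t * h)
    half-positive t (0≤t , t≢0) = *-nonneg t h 0≤t 0≤h , λ th≡0 →
      t≢0 (trans (sym (halves t)) (trans (cong₂ _+_ th≡0 th≡0) (+-identityˡ 0#)))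
    v+v≤positives : ∀ t → Positive t → v + v ≤ t
    v+v≤positives t t>0 = subst (v + v ≤_) (halves t) (+-mono-≤ v≤t/2 v≤t/2)
      where
      v≤t/2 : v ≤ t * h
      v≤t/2 = lower v-inf (t * h) (half-positive t t>0)
    v≤0 : v ≤ 0#
    v≤0 = +-cancelˡ-≤ v (subst (v + v ≤_) (sym (+-identityʳ v))
            (greatest v-inf (v + v) v+v≤positives))

  nonNeg-stable : ∀ {x} → Stable (0# ≤ x)
  nonNeg-stable {x} ¬¬0≤x = neg-nonPos⇒nonNeg (≤-positives⇒≤0 -x≤positives)
    where
    -x≤positives : ∀ t → Positive t → - x ≤ t
    -x≤positives t (0≤t , t≢0) with total (- x) t
    ... | inj₁ -x≤t = -x≤t
    ... | inj₂ t≤-x = ⊥-elim (¬¬0≤x λ 0≤x →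
      t≢0 (antisym (≤-trans t≤-x (nonNeg⇒neg-nonPos 0≤x)) 0≤t))

  ≤-stable : ∀ {x y} → Stable (x ≤ y)
  ≤-stable ¬¬x≤y = 0≤y-x⇒x≤y (nonNeg-stable (¬¬-map x≤y⇒0≤y-x ¬¬x≤y))

  infimum-+-≤ : ∀ {P Q S u v w} →
                IsInfimum _≤_ P u → IsInfimum _≤_ Q v → IsInfimum _≤_ S w →
                (∀ s → S s → ¬ ¬ ∃₂ λ p q → P p × Q q × p + q ≡ s) → u + v ≤ w
  infimum-+-≤ {P} {Q} {u = u} {v} u-inf v-inf w-inf split =
    greatest w-inf (u + v) λ s Ss → ≤-stable (¬¬-map u+v≤ (split s Ss))
    where
    u+v≤ : ∀ {s} → ∃₂ (λ p q → P p × Q q × p + q ≡ s) → u + v ≤ s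
    u+v≤ (p , q , Pp , Qq , refl) =
      +-mono-≤ (lower u-inf p Pp) (lower v-inf q Qq)

  infimum-*-≤ : ∀ {n P Q v w} → Positive n →
                IsInfimum _≤_ P v → IsInfimum _≤_ Q w →
                (∀ p → P p → Q (n * p)) → w ≤ n * v
  infimum-*-≤ {n} {v = v} {w} n>0 v-inf w-inf scale with positive-inverse n>0
  ... | m , nm≡1 , _ = subst (_≤ n * v) n[mw]≡w (*-monoˡ-≤-nonNeg (proj₁ n>0) mw≤v)
    where
    n[mw]≡w : n * (m * w) ≡ w
    n[mw]≡w = begin
      n * (m * w)  ≡⟨ *-assoc n m w ⟨
      (n * m) * w  ≡⟨ cong (_* w) nm≡1 ⟩
      1# * w       ≡⟨ *-identityˡ w ⟩
      w            ∎
    mw≤v : m * w ≤ v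
    mw≤v = greatest v-inf (m * w) λ p Pp → *-cancelˡ-≤-pos n>0
      (subst (_≤ n * p) (sym n[mw]≡w) (lower w-inf (n * p) (scale p Pp)))

module Soundness (ℝ : RealField) (M : KAModel ℝ) where
  open RealField ℝ
  open OrderedFieldProperties ℝ
  open KAModel M
  open IsCommutativeRing isCommutativeRing using (+-identityˡ; -‿inverseʳ; zeroʳ)
  open IsInfimum
  open RawMonad (¬¬-Monad {0ℓ}) using (pure; _>>=_)

  ⟦_⟧_≔_ : Fm → W → Carrier → Set
  ⟦ φ ⟧ x ≔ v = Val ℝ M φ x v

  successor-values : Fm → W → Carrier → Set
  successor-values φ x b = ∃[ y ] (R x y × ⟦ φ ⟧ y ≔ b)

  Val-functional : ∀ φ {x a b} → ⟦ φ ⟧ x ≔ a → ⟦ φ ⟧ x ≔ b → a ≡ b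
  Val-functional (var p)  refl refl = refl
  Val-functional (φ ⇒ ψ) (a , b , va , vb , refl) (a′ , b′ , va′ , vb′ , refl) =
    cong₂ _-_ (Val-functional ψ vb vb′) (Val-functional φ va va′)
  Val-functional (□ φ) (inj₁ (_ , refl)) (inj₁ (_ , refl)) = refl
  Val-functional (□ φ) (inj₁ (∄y , _))   (inj₂ (∃y , _))   = ⊥-elim (∄y ∃y)
  Val-functional (□ φ) (inj₂ (∃y , _))   (inj₁ (∄y , _))   = ⊥-elim (∄y ∃y)
  Val-functional (□ φ) (inj₂ (_ , inf))  (inj₂ (_ , inf′)) = infimum-unique inf inf′

  Val-□-dead-end : ∀ φ {x v} → ¬ ∃ (R x) → ⟦ □ φ ⟧ x ≔ v → v ≡ 0#
  Val-□-dead-end φ _   (inj₁ (_ , v≡0))  = v≡0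
  Val-□-dead-end φ ∄y  (inj₂ (∃y , _))   = ⊥-elim (∄y ∃y)

  Val-□-infimum : ∀ φ {x v} → ∃ (R x) → ⟦ □ φ ⟧ x ≔ v → IsInfimum _≤_ (successor-values φ x) v
  Val-□-infimum φ ∃y (inj₁ (∄y , _))  = ⊥-elim (∄y ∃y)
  Val-□-infimum φ _  (inj₂ (_ , inf)) = inf

  bound : Fm → Carrier
  bound (var p) = r
  bound (φ ⇒ ψ) = bound φ + bound ψ
  bound (□ φ)   = bound φ

  bound-nonNeg : ∀ φ → 0# ≤ bound φ
  bound-nonNeg (var p) = 0≤r
  bound-nonNeg (φ ⇒ ψ) = subst (_≤ bound φ + bound ψ) (+-identityˡ 0#)
                           (+-mono-≤ (bound-nonNeg φ) (bound-nonNeg ψ))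
  bound-nonNeg (□ φ)   = bound-nonNeg φ

  Val-bounded : ∀ φ {x v} → ⟦ φ ⟧ x ≔ v → Bounded (bound φ) v
  Val-exists : ∀ φ x → ¬ ¬ ∃ (⟦ φ ⟧ x ≔_)

  Val-bounded (var p) {x} refl = bounded p x
  Val-bounded (φ ⇒ ψ) (a , b , va , vb , refl) = sub-bounded (Val-bounded φ va) (Val-bounded ψ vb)
  Val-bounded (□ φ) (inj₁ (_ , refl)) = 0-bounded (bound-nonNeg φ)
  Val-bounded (□ φ) (inj₂ ((y , Rxy) , inf)) =
    greatest inf _ (λ _ (_ , _ , vb) → proj₁ (Val-bounded φ vb)) ,
    ≤-stable do
      (c , vc) ← Val-exists φ y
      pure (≤-trans (lower inf c (y , Rxy , vc)) (proj₂ (Val-bounded φ vc)))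

  Val-exists (var p) x = pure (V p x , refl)
  Val-exists (φ ⇒ ψ) x = do
    (a , va) ← Val-exists φ x
    (b , vb) ← Val-exists ψ x
    pure (b - a , a , b , va , vb , refl)
  Val-exists (□ φ) x = do
    yes (y , Rxy) ← ¬¬-excluded-middle {A = ∃ (R x)}
      where no ∄y → pure (0# , inj₁ (∄y , refl))
    (c , vc) ← Val-exists φ y
    let lower-bound = λ _ (_ , _ , vb) → proj₁ (Val-bounded φ vb)
        (v , inf) = complete (successor-values φ x) (c , y , Rxy , vc) (- bound φ , lower-bound)
    pure (v , inj₂ ((y , Rxy) , inf))

  Val-0̄ : ∀ {x} → ⟦ 0̄ ⟧ x ≔ 0#
  Val-0̄ {x} = V p₀ x , V p₀ x , refl , refl , sym (-‿inverseʳ (V p₀ x))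

  Val-· : ∀ n φ {x c} → ⟦ φ ⟧ x ≔ c → ⟦ n · φ ⟧ x ≔ (n ·ℝ c)
  Val-· zero    φ vc = Val-0̄
  Val-· (suc n) φ {x} {c} vc = subst (⟦ suc n · φ ⟧ x ≔_) (sub-[0-y] (n ·ℝ c) c)
    (0# - c , n ·ℝ c , (c , 0# , vc , Val-0̄ , refl) , Val-· n φ vc , refl)

  axK-sound : ∀ φ ψ {x a a′ b′} →
            ⟦ □ (φ ⇒ ψ) ⟧ x ≔ a → ⟦ □ φ ⟧ x ≔ a′ → ⟦ □ ψ ⟧ x ≔ b′ → 0# ≤ (b′ - a′) - a
  axK-sound φ ψ {x} {a} {a′} {b′} va va′ vb′ =
    subst (0# ≤_) (sym (trans (sub-sub-comm b′ a′ a) (sub-sub b′ a a′))) (x≤y⇒0≤y-x a+a′≤b′)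
    where
    open ≡-Reasoning
    split : ∀ b → successor-values ψ x b →
            ¬ ¬ ∃₂ λ p q → successor-values (φ ⇒ ψ) x p × successor-values φ x q × p + q ≡ b
    split b (y , Rxy , vb) = do
      (c , vc) ← Val-exists φ y
      pure (b - c , c , (y , Rxy , c , b , vc , vb , refl) , (y , Rxy , vc) , //-rightDividesˡ c b)
    a+a′≤b′ : a + a′ ≤ b′
    a+a′≤b′ = ≤-stable do
      yes ∃y ← ¬¬-excluded-middle {A = ∃ (R x)}
        where no ∄y → pure (≤-reflexive (begin
                a + a′   ≡⟨ cong₂ _+_ (Val-□-dead-end (φ ⇒ ψ) ∄y va) (Val-□-dead-end φ ∄y va′) ⟩
                0# + 0#  ≡⟨ +-identityˡ 0# ⟩
                0#       ≡⟨ Val-□-dead-end ψ ∄y vb′ ⟨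
                b′       ∎))
      pure (infimum-+-≤ (Val-□-infimum (φ ⇒ ψ) ∃y va) (Val-□-infimum φ ∃y va′)
                        (Val-□-infimum ψ ∃y vb′) split)

  □·≤·□ : ∀ m φ {x a c} → ⟦ □ (suc m · φ) ⟧ x ≔ a → ⟦ □ φ ⟧ x ≔ c → a ≤ suc m ·ℝ c
  □·≤·□ m φ {x} {a} {c} va vc = ≤-stable do
    yes ∃y ← ¬¬-excluded-middle {A = ∃ (R x)}
      where no ∄y → pure (≤-reflexive (begin
              a                   ≡⟨ Val-□-dead-end (n · φ) ∄y va ⟩
              0#                  ≡⟨ zeroʳ (n ·ℝ 1#) ⟨
              (n ·ℝ 1#) * 0#      ≡⟨ ·ℝ-as-* n 0# ⟨
              n ·ℝ 0#             ≡⟨ cong (n ·ℝ_) (Val-□-dead-end φ ∄y vc) ⟨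
              n ·ℝ c              ∎))
    pure (subst (a ≤_) (sym (·ℝ-as-* n c))
      (infimum-*-≤ (suc·ℝ1-positive m) (Val-□-infimum φ ∃y vc) (Val-□-infimum (n · φ) ∃y va) scale))
    where
    open ≡-Reasoning
    n = suc m
    scale : ∀ b → successor-values φ x b → successor-values (n · φ) x ((n ·ℝ 1#) * b)
    scale b (y , Rxy , vb) = y , Rxy , subst (⟦ n · φ ⟧ y ≔_) (·ℝ-as-* n b) (Val-· n φ vb)

  sound : ∀ {φ} → ⊢ φ → ∀ x {v} → ⟦ φ ⟧ x ≔ v → 0# ≤ v
  sound (axI φ) x (a , b , va , vb , refl) = x≤y⇒0≤y-x (≤-reflexive (Val-functional φ va vb))
  sound (axB φ ψ χ) x
    (_ , _ , (f , p , vf , vp , refl) ,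
     (_ , _ , (p′ , c , vp′ , vc , refl) , (f′ , c′ , vf′ , vc′ , refl) , refl) , refl)
    rewrite Val-functional χ vc′ vc | Val-functional φ vf′ vf | Val-functional ψ vp′ vp =
    x≤y⇒0≤y-x (≤-reflexive (sym (sub-sub-cancelˡ c f p)))
  sound (axC φ ψ χ) x
    (_ , _ , (f , _ , vf , (p , c , vp , vc , refl) , refl) ,
     (p′ , _ , vp′ , (f′ , c′ , vf′ , vc′ , refl) , refl) , refl)
    rewrite Val-functional χ vc′ vc | Val-functional φ vf′ vf | Val-functional ψ vp′ vp =
    x≤y⇒0≤y-x (≤-reflexive (sub-sub-comm c p f))
  sound (axA φ ψ) x (_ , f′ , (_ , p′ , (f , p , vf , vp , refl) , vp′ , refl) , vf′ , refl)
    rewrite Val-functional φ vf′ vf | Val-functional ψ vp′ vp =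
    x≤y⇒0≤y-x (≤-reflexive (sub-sub-cancel p f))
  sound (axK φ ψ) x (_ , _ , va , (_ , _ , va′ , vb′ , refl) , refl) = axK-sound φ ψ va va′ vb′
  sound (axD (suc m) φ _) x (a , b , va , vb , refl) = x≤y⇒0≤y-x (≤-stable do
    (c , vc) ← Val-exists (□ φ) x
    pure (subst (a ≤_) (Val-functional (suc m · (□ φ)) (Val-· (suc m) (□ φ) vc) vb)
                       (□·≤·□ m φ va vc)))
  sound (mp {φ} ⊢φ ⊢φ⇒ψ) x {b} vb = ≤-stable do
    (a , va) ← Val-exists φ x
    pure (≤-trans (sound ⊢φ x va) (0≤y-x⇒x≤y (sound ⊢φ⇒ψ x (a , b , va , vb , refl))))
  sound (nec ⊢φ) x (inj₁ (_ , refl)) = ≤-refl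
  sound (nec ⊢φ) x (inj₂ (_ , inf)) = greatest inf 0# λ _ (y , _ , vb) → sound ⊢φ y vb
  sound (con {φ} (suc m) _ ⊢nφ) x {a} va = *-cancelˡ-≤-pos (suc·ℝ1-positive m)
    (subst₂ _≤_ (sym (zeroʳ _)) (·ℝ-as-* (suc m) a) (sound ⊢nφ x (Val-· (suc m) φ va)))

proposition4p1 : (φ : Fm) → ⊢ φ → KA-valid φ
proposition4p1 φ ⊢φ ℝ M x v = Soundness.sound ℝ M ⊢φ x
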